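{- For integers $n, \alpha, \beta$ with $n$ even, let $G^{(11)}(n;\alpha,\beta)$ be the graph with vertex set $\{a'_j, a''_j, b'_j, b''_j, c'_j, c''_j, d'_j, d''_j, e'_j, e''_j, f_j : j \in \mathbb{Z}_n\}$ and edges, for every $j \in \mathbb{Z}_n$: $a'_j a''_j$, $a'_j b'_j$, $a'_j b'_{j+\alpha}$, $a''_j b''_j$, $a''_j b''_{j+\beta}$, $b'_j c'_j$, $b''_j c''_j$, $c'_j c'_{j+n/2}$, $c''_j c''_{j+n/2}$, $c'_j d'_j$, $c''_j d''_j$, $d'_j d'_{j+n/2}$, $d''_j d''_{j+n/2}$, $d'_j e'_j$, $d''_j e''_j$, $e'_j e''_j$, $e'_j f_j$, $e''_j f_j$, $f_j f_{j+n/2}$. If $n \ge 6$, $n \equiv 2 \pmod 4$ and $\alpha = \beta = 2$, then $G^{(11)}(n;\alpha,\beta)$ is a nut graph.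
   Context: A nut graph is a simple graph with at least two vertices whose adjacency matrix has a one-dimensional null space spanned by a vector with no zero entries. -}

module Defs where

open import Data.Nat as ℕ using (ℕ; zero; suc; NonZero; _≤_)
open import Data.Nat.DivMod using (_%_; _/_; m%n<n)
open import Data.Integer as ℤ using (ℤ; _%ℕ_)
open import Data.Fin as Fin using (Fin; toℕ; fromℕ<; remQuot)
open import Data.Fin.Properties using () renaming (_≟_ to _≟F_)
open import Data.Bool using (Bool; true; false; _∨_; if_then_else_)
open import Data.Product using (_×_; _,_; Σ; ∃)
open import Data.Rational as ℚ using (ℚ; 0ℚ; 1ℚ)
open import Relation.Binary.PropositionalEquality using (_≡_; _≢_)
open import Relation.Nullary.Decidable using (⌊_⌋)

sumFin : (N : ℕ) → (Fin N → ℚ) → ℚ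
sumFin zero    f = 0ℚ
sumFin (suc N) f = f Fin.zero ℚ.+ sumFin N (λ i → f (Fin.suc i))

Graph : ℕ → Set
Graph N = Fin N → Fin N → Bool

IsSimple : (N : ℕ) → Graph N → Set
IsSimple N G = (∀ i j → G i j ≡ G j i) × (∀ i → G i i ≡ false)

adjMatrix : {N : ℕ} → Graph N → Fin N → Fin N → ℚ
adjMatrix G i j = if G i j then 1ℚ else 0ℚ

InNullSpace : (N : ℕ) → Graph N → (Fin N → ℚ) → Set
InNullSpace N G x = ∀ i → sumFin N (λ j → adjMatrix G i j ℚ.* x j) ≡ 0ℚ

IsNutGraph : (N : ℕ) → Graph N → Set
IsNutGraph N G =
  (2 ≤ N) × IsSimple N G ×
  Σ (Fin N → ℚ) λ x →
    (∀ i → x i ≢ 0ℚ) × InNullSpace N G x ×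
    (∀ y → InNullSpace N G y → ∃ λ (c : ℚ) → ∀ i → y i ≡ c ℚ.* x i)

data Cls : Set where
  a' a'' b' b'' c' c'' d' d'' e' e'' f : Cls

cls : Fin 11 → Cls
cls Fin.zero = a'
cls (Fin.suc Fin.zero) = a''
cls (Fin.suc (Fin.suc Fin.zero)) = b'
cls (Fin.suc (Fin.suc (Fin.suc Fin.zero))) = b''
cls (Fin.suc (Fin.suc (Fin.suc (Fin.suc Fin.zero)))) = c'
cls (Fin.suc (Fin.suc (Fin.suc (Fin.suc (Fin.suc Fin.zero))))) = c''
cls (Fin.suc (Fin.suc (Fin.suc (Fin.suc (Fin.suc (Fin.suc Fin.zero)))))) = d'
cls (Fin.suc (Fin.suc (Fin.suc (Fin.suc (Fin.suc (Fin.suc (Fin.suc Fin.zero))))))) = d''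
cls (Fin.suc (Fin.suc (Fin.suc (Fin.suc (Fin.suc (Fin.suc (Fin.suc (Fin.suc Fin.zero)))))))) = e'
cls (Fin.suc (Fin.suc (Fin.suc (Fin.suc (Fin.suc (Fin.suc (Fin.suc (Fin.suc (Fin.suc Fin.zero))))))))) = e''
cls (Fin.suc (Fin.suc (Fin.suc (Fin.suc (Fin.suc (Fin.suc (Fin.suc (Fin.suc (Fin.suc (Fin.suc Fin.zero)))))))))) = f

module _ (n : ℕ) .{{_ : NonZero n}} where

  _⊕_ : Fin n → ℕ → Fin n
  j ⊕ k = fromℕ< (m%n<n (toℕ j ℕ.+ k) n)

  red : ℤ → ℕ
  red z = z %ℕ n

  eqB : Fin n → Fin n → Bool
  eqB j k = ⌊ j ≟F k ⌋

  -- generating edges: gen α β (X , j) (Y , k) holds iff XjYk is one of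
  -- the listed edges (in the listed orientation)
  gen : ℤ → ℤ → Cls × Fin n → Cls × Fin n → Bool
  gen α β (a'  , j) (a'' , k) = eqB k j
  gen α β (a'  , j) (b'  , k) = eqB k j ∨ eqB k (j ⊕ red α)
  gen α β (a'' , j) (b'' , k) = eqB k j ∨ eqB k (j ⊕ red β)
  gen α β (b'  , j) (c'  , k) = eqB k j
  gen α β (b'' , j) (c'' , k) = eqB k j
  gen α β (c'  , j) (c'  , k) = eqB k (j ⊕ (n / 2))
  gen α β (c'' , j) (c'' , k) = eqB k (j ⊕ (n / 2))
  gen α β (c'  , j) (d'  , k) = eqB k j
  gen α β (c'' , j) (d'' , k) = eqB k j
  gen α β (d'  , j) (d'  , k) = eqB k (j ⊕ (n / 2))
  gen α β (d'' , j) (d'' , k) = eqB k (j ⊕ (n / 2))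
  gen α β (d'  , j) (e'  , k) = eqB k j
  gen α β (d'' , j) (e'' , k) = eqB k j
  gen α β (e'  , j) (e'' , k) = eqB k j
  gen α β (e'  , j) (f   , k) = eqB k j
  gen α β (e'' , j) (f   , k) = eqB k j
  gen α β (f   , j) (f   , k) = eqB k (j ⊕ (n / 2))
  gen α β _ _ = false

  -- vertex index v ∈ Fin (11 * n) corresponds to (class , j) via remQuot
  vtx : Fin (11 ℕ.* n) → Cls × Fin n
  vtx v with remQuot n v
  ... | (c , j) = (cls c , j)

  G11 : ℤ → ℤ → Graph (11 ℕ.* n)
  G11 α β u v = gen α β (vtx u) (vtx v) ∨ gen α β (vtx v) (vtx u)

{-# OPTIONS --safe #-}
-- Write n = 2h with h odd and let H be the translation j ↦ j + h of ℤ_n, an involution.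
-- Solving the rows of A z = 0 for f, d′, c′, b′, a″ (and, by the symmetry exchanging primed
-- and double-primed vertices, for their mirror images) expresses every coordinate through
-- x = z(e′) and y = z(e″); the rows b″ and b′ then become the twisted recurrences
--   x(j−2+h) + x(j+h) + x(j+2+h) + 2y(j) + x(j) = 0   and its mirror image.
-- Their difference w = x − y has H-even part p with p(j−2) + p(j+2) = 0 and H-odd part m
-- with m(j−2) + 2m(j) + m(j+2) = 0. Translation by 2 has odd order h, so both vanish and
-- y = x. Now x satisfies the twisted recurrence with constant 3: its H-even part satisfies
-- p(j−2) + 4p(j) + p(j+2) = 0 and vanishes by the maximum principle, so x ∘ H = −x, and its
-- H-odd part 2x satisfies m(j−2) − 2m(j) + m(j+2) = 0, whose only solutions on a finite
-- cycle over ℚ are 2-periodic. Hence x(j+1) = x(j+h) = −x(j), so x is a multiple of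
-- (−1)^j, and then so is every other class, with weights (2,2,−1,−1,−4,−4,−3,−3,1,1,2).
module Submission where

open import Defs
open import Data.Nat using (ℕ; NonZero; _≤_; _*_)
open import Data.Nat.DivMod using (_%_)
open import Data.Integer using (+_)
open import Relation.Binary.PropositionalEquality using (_≡_)

open import Algebra.Bundles using (CommutativeRing)
open import Data.Bool using (Bool; true; false; T; _∨_; if_then_else_)
open import Data.Bool.Properties using (T-∨; ∨-comm)
open import Data.Empty using (⊥-elim)
open import Data.Fin using (Fin; zero; suc; #_; toℕ; fromℕ<; combine; remQuot; _↑ˡ_; _↑ʳ_)
import Data.Fin.Properties as Finₚ
open import Data.List using (allFin)
open import Data.List.Membership.Propositional.Properties using (∈-allFin)
open import Data.List.Relation.Unary.All using (lookup)
open import Data.Nat as ℕ using (zero; suc; nonZero; _∸_; _<_; z≤n; s≤s)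
import Data.Nat.Properties as ℕₚ
open import Data.Nat.DivMod
  using (_/_; /-congˡ; %-distribˡ-+; m%n%n≡m%n; %-remove-+ʳ; m<n⇒m%n≡m; m≡m%n+[m/n]*n; m*n/n≡m)
open import Data.Nat.Divisibility using (_∣_; divides; ∣-reflexive; ∣⇒≤; ∣m∣n⇒∣m+n; m∣m*n)
open import Data.Product using (_×_; _,_; proj₁; proj₂; ∃; uncurry)
open import Data.Rational as ℚ using (ℚ; 0ℚ; 1ℚ; ½; _+_; -_; _-_; ∣_∣; 1/_) renaming (_*_ to _·_)
import Data.Rational.Properties as ℚₚ
open import Data.Sum using (_⊎_; inj₁; inj₂; [_,_]; [_,_]′)
open import Data.Unit using (tt)
open import Function using (_∘_; Equivalence)
open import Level using (0ℓ)
open import Relation.Binary.Bundles using (DecTotalOrder)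
open import Relation.Binary.PropositionalEquality
  using (_≢_; refl; sym; trans; cong; cong₂; subst; module ≡-Reasoning)
open import Relation.Nullary using (¬_)
open import Relation.Nullary.Decidable using (toWitness; fromWitness; dec⇒maybe; isYes≗does; dec-false)
open import Tactic.RingSolver using (solve-∀)
open import Tactic.RingSolver.Core.AlmostCommutativeRing using (AlmostCommutativeRing; fromCommutativeRing)
open import Algebra.Properties.Semiring.Mult (CommutativeRing.semiring ℚₚ.+-*-commutativeRing)
  using (×-assoc-*) renaming (_×_ to _×ₘ_)
open import Data.List.Extrema (DecTotalOrder.totalOrder ℚₚ.≤-decTotalOrder) using (argmax; f[xs]≤f[argmax])

ℚ-ring : AlmostCommutativeRing 0ℓ 0ℓ
ℚ-ring = fromCommutativeRing ℚₚ.+-*-commutativeRing (dec⇒maybe ∘ (0ℚ ℚₚ.≟_))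

2ℚ 3ℚ 4ℚ : ℚ
2ℚ = 1ℚ + 1ℚ
3ℚ = 2ℚ + 1ℚ
4ℚ = 2ℚ + 2ℚ

x≡-x⇒x≡0 : ∀ {x} → x ≡ - x → x ≡ 0ℚ
x≡-x⇒x≡0 {x} x≡-x = begin
  x             ≡⟨ half-double x ⟩
  ½ · (x + x)   ≡⟨ cong (λ t → ½ · (x + t)) x≡-x ⟩
  ½ · (x - x)   ≡⟨ cong (½ ·_) (ℚₚ.+-inverseʳ x) ⟩
  ½ · 0ℚ        ≡⟨ ℚₚ.*-zeroʳ ½ ⟩
  0ℚ            ∎
  where
  open ≡-Reasoning
  half-double : ∀ x → x ≡ ½ · (x + x)
  half-double = solve-∀ ℚ-ring

*-cancelˡ-≡0 : ∀ c .{{_ : ℚ.NonZero c}} {x} → c · x ≡ 0ℚ → x ≡ 0ℚ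
*-cancelˡ-≡0 c {x} cx≡0 = begin
  x                 ≡⟨ ℚₚ.*-identityˡ x ⟨
  1ℚ · x            ≡⟨ cong (_· x) (ℚₚ.*-inverseˡ c) ⟨
  (1/ c · c) · x    ≡⟨ ℚₚ.*-assoc (1/ c) c x ⟩
  1/ c · (c · x)    ≡⟨ cong (1/ c ·_) cx≡0 ⟩
  1/ c · 0ℚ         ≡⟨ ℚₚ.*-zeroʳ (1/ c) ⟩
  0ℚ                ∎
  where open ≡-Reasoning

×ₘ-one-positive : ∀ i → ℚ.Positive (suc i ×ₘ 1ℚ)
×ₘ-one-positive zero    = _
×ₘ-one-positive (suc i) = ℚₚ.pos+pos⇒pos 1ℚ (suc i ×ₘ 1ℚ) {{×ₘ-one-positive i}}

×ₘ-cancel : ∀ i .{{_ : ℕ.NonZero i}} {x} → i ×ₘ x ≡ 0ℚ → x ≡ 0ℚ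
×ₘ-cancel (suc i) {x} ix≡0 = *-cancelˡ-≡0 (suc i ×ₘ 1ℚ) {{i×1≢0}} (begin
  (suc i ×ₘ 1ℚ) · x   ≡⟨ ×-assoc-* (suc i) 1ℚ x ⟩
  suc i ×ₘ (1ℚ · x)   ≡⟨ cong (suc i ×ₘ_) (ℚₚ.*-identityˡ x) ⟩
  suc i ×ₘ x          ≡⟨ ix≡0 ⟩
  0ℚ                  ∎)
  where
  open ≡-Reasoning
  i×1≢0 = ℚₚ.pos⇒nonZero (suc i ×ₘ 1ℚ) {{×ₘ-one-positive i}}

by-vanishing : ∀ {L R E} → L ≡ R + E → E ≡ 0ℚ → L ≡ R
by-vanishing {R = R} L≡R+E E≡0 = trans L≡R+E (trans (cong (_+_ R) E≡0) (ℚₚ.+-identityʳ R))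

isolateˡ : ∀ {a} b c → a + (b + c) ≡ 0ℚ → a ≡ - (b + c)
isolateˡ {a} b c eq = by-vanishing (shuffle a b c) eq
  where
  shuffle : ∀ a b c → a ≡ - (b + c) + (a + (b + c))
  shuffle = solve-∀ ℚ-ring

isolateʳ : ∀ a b {c} → a + (b + c) ≡ 0ℚ → c ≡ - (a + b)
isolateʳ a b {c} eq = by-vanishing (shuffle a b c) eq
  where
  shuffle : ∀ a b c → c ≡ - (a + b) + (a + (b + c))
  shuffle = solve-∀ ℚ-ring

sumFin-cong : ∀ N {F G : Fin N → ℚ} → (∀ i → F i ≡ G i) → sumFin N F ≡ sumFin N G
sumFin-cong zero    F≗G = refl
sumFin-cong (suc N) F≗G = cong₂ _+_ (F≗G zero) (sumFin-cong N (F≗G ∘ suc))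

sumFin-zero : ∀ N {F : Fin N → ℚ} → (∀ i → F i ≡ 0ℚ) → sumFin N F ≡ 0ℚ
sumFin-zero N F≗0 = trans (sumFin-cong N F≗0) (all-zero N)
  where
  all-zero : ∀ N → sumFin N (λ _ → 0ℚ) ≡ 0ℚ
  all-zero zero    = refl
  all-zero (suc N) = cong (_+_ 0ℚ) (all-zero N)

sumFin-point : ∀ {N} (F : Fin N → ℚ) t → (∀ i → i ≢ t → F i ≡ 0ℚ) → sumFin N F ≡ F t
sumFin-point {suc N} F zero F≡0 = begin
  F zero + sumFin N (F ∘ suc)  ≡⟨ cong (_+_ (F zero)) (sumFin-zero N λ i → F≡0 (suc i) λ ()) ⟩
  F zero + 0ℚ                  ≡⟨ ℚₚ.+-identityʳ (F zero) ⟩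
  F zero                       ∎
  where open ≡-Reasoning
sumFin-point {suc N} F (suc t) F≡0 = begin
  F zero + sumFin N (F ∘ suc)  ≡⟨ cong₂ _+_ (F≡0 zero λ ()) (sumFin-point (F ∘ suc) t F∘suc≡0) ⟩
  0ℚ + F (suc t)               ≡⟨ ℚₚ.+-identityˡ (F (suc t)) ⟩
  F (suc t)                    ∎
  where
  open ≡-Reasoning
  F∘suc≡0 : ∀ i → i ≢ t → F (suc i) ≡ 0ℚ
  F∘suc≡0 i i≢t = F≡0 (suc i) (i≢t ∘ Finₚ.suc-injective)

sumFin-two-points : ∀ {N} (F : Fin N → ℚ) {t s} → t ≢ s →
                    (∀ i → i ≢ t → i ≢ s → F i ≡ 0ℚ) → sumFin N F ≡ F t + F s
sumFin-two-points {suc N} F {zero}  {zero}  t≢s F≡0 = ⊥-elim (t≢s refl)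
sumFin-two-points {suc N} F {zero}  {suc s} t≢s F≡0 =
  cong (_+_ (F zero)) (sumFin-point (F ∘ suc) s λ i i≢s → F≡0 (suc i) (λ ()) (i≢s ∘ Finₚ.suc-injective))
sumFin-two-points {suc N} F {suc t} {zero}  t≢s F≡0 = begin
  F zero + sumFin N (F ∘ suc)  ≡⟨ cong (_+_ (F zero)) (sumFin-point (F ∘ suc) t F∘suc≡0) ⟩
  F zero + F (suc t)           ≡⟨ ℚₚ.+-comm (F zero) (F (suc t)) ⟩
  F (suc t) + F zero           ∎
  where
  open ≡-Reasoning
  F∘suc≡0 : ∀ i → i ≢ t → F (suc i) ≡ 0ℚ
  F∘suc≡0 i i≢t = F≡0 (suc i) (i≢t ∘ Finₚ.suc-injective) (λ ())
sumFin-two-points {suc N} F {suc t} {suc s} t≢s F≡0 = begin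
  F zero + sumFin N (F ∘ suc)
    ≡⟨ cong₂ _+_ (F≡0 zero (λ ()) (λ ())) (sumFin-two-points (F ∘ suc) (t≢s ∘ cong suc) F∘suc≡0) ⟩
  0ℚ + (F (suc t) + F (suc s))
    ≡⟨ ℚₚ.+-identityˡ _ ⟩
  F (suc t) + F (suc s)
    ∎
  where
  open ≡-Reasoning
  F∘suc≡0 : ∀ i → i ≢ t → i ≢ s → F (suc i) ≡ 0ℚ
  F∘suc≡0 i i≢t i≢s = F≡0 (suc i) (i≢t ∘ Finₚ.suc-injective) (i≢s ∘ Finₚ.suc-injective)

sumFin-↑ : ∀ a b (F : Fin (a ℕ.+ b) → ℚ) →
           sumFin (a ℕ.+ b) F ≡ sumFin a (F ∘ (_↑ˡ b)) + sumFin b (F ∘ (a ↑ʳ_))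
sumFin-↑ zero    b F = sym (ℚₚ.+-identityˡ _)
sumFin-↑ (suc a) b F = begin
  F zero + sumFin (a ℕ.+ b) (F ∘ suc)                                    ≡⟨ cong (_+_ (F zero)) (sumFin-↑ a b (F ∘ suc)) ⟩
  F zero + (sumFin a (F ∘ suc ∘ (_↑ˡ b)) + sumFin b (F ∘ suc ∘ (a ↑ʳ_)))  ≡⟨ ℚₚ.+-assoc (F zero) _ _ ⟨
  F zero + sumFin a (F ∘ suc ∘ (_↑ˡ b)) + sumFin b (F ∘ suc ∘ (a ↑ʳ_))    ∎
  where open ≡-Reasoning

sumFin-combine : ∀ m n (F : Fin (m * n) → ℚ) →
                 sumFin (m * n) F ≡ sumFin m (λ c → sumFin n (λ k → F (combine c k)))
sumFin-combine zero    n F = refl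
sumFin-combine (suc m) n F =
  trans (sumFin-↑ n (m * n) F) (cong (_+_ (sumFin n (F ∘ (_↑ˡ m * n)))) (sumFin-combine m n (F ∘ (n ↑ʳ_))))

indicator : Bool → ℚ
indicator b = if b then 1ℚ else 0ℚ

-- `indicator b · x`, rewritten to reduce on b: ℚ multiplication does not compute on open
-- terms, so summands of that form cannot be matched by unification.
when : Bool → ℚ → ℚ
when true  x = x
when false x = 0ℚ

indicator-when : ∀ b x → indicator b · x ≡ when b x
indicator-when true  x = ℚₚ.*-identityˡ x
indicator-when false x = ℚₚ.*-zeroˡ x

when-false : ∀ {b} x → ¬ T b → when b x ≡ 0ℚ
when-false {false} x _  = refl
when-false {true}  x ¬T = ⊥-elim (¬T tt)

when-true : ∀ {b} x → T b → when b x ≡ x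
when-true {true} x _ = refl

sumFin-when-point : ∀ {N} (P : Fin N → Bool) (u : Fin N → ℚ) {t} →
                    (∀ k → T (P k) → k ≡ t) → T (P t) → sumFin N (λ k → when (P k) (u k)) ≡ u t
sumFin-when-point P u {t} P⇒≡t Pt =
  trans (sumFin-point _ t λ k k≢t → when-false (u k) (k≢t ∘ P⇒≡t k)) (when-true (u t) Pt)

sumFin-when-two-points : ∀ {N} (P : Fin N → Bool) (u : Fin N → ℚ) {t s} → t ≢ s →
                         (∀ k → T (P k) → k ≡ t ⊎ k ≡ s) → T (P t) → T (P s) →
                         sumFin N (λ k → when (P k) (u k)) ≡ u t + u s
sumFin-when-two-points P u {t} {s} t≢s P⇒t∨s Pt Ps =
  trans (sumFin-two-points _ t≢s λ k k≢t k≢s → when-false (u k) ([ k≢t , k≢s ] ∘ P⇒t∨s k))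
        (cong₂ _+_ (when-true (u t) Pt) (when-true (u s) Ps))

∨-elim : ∀ b {c} → T (b ∨ c) → T b ⊎ T c
∨-elim b = Equivalence.to (T-∨ {b})

∨-introˡ : ∀ {b c} → T b → T (b ∨ c)
∨-introˡ = Equivalence.from T-∨ ∘ inj₁

∨-introʳ : ∀ b {c} → T c → T (b ∨ c)
∨-introʳ b = Equivalence.from (T-∨ {b}) ∘ inj₂

sign : ℕ → ℚ
sign zero    = 1ℚ
sign (suc i) = - sign i

sign-+ : ∀ i j → sign (i ℕ.+ j) ≡ sign i · sign j
sign-+ zero    j = sym (ℚₚ.*-identityˡ (sign j))
sign-+ (suc i) j = trans (cong -_ (sign-+ i j)) (ℚₚ.neg-distribˡ-* (sign i) (sign j))

sign-*2 : ∀ k → sign (k * 2) ≡ 1ℚ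
sign-*2 zero    = refl
sign-*2 (suc k) = trans (double-negation (sign (k * 2))) (sign-*2 k)
  where
  double-negation : ∀ x → - - x ≡ x
  double-negation = solve-∀ ℚ-ring

sign-odd : ∀ k → sign (suc (k * 2)) ≡ - 1ℚ
sign-odd k = cong -_ (sign-*2 k)

sign-squared : ∀ i → sign i · sign i ≡ 1ℚ
sign-squared zero    = refl
sign-squared (suc i) = trans (negations-cancel (sign i)) (sign-squared i)
  where
  negations-cancel : ∀ x → - x · - x ≡ x · x
  negations-cancel = solve-∀ ℚ-ring

-- A discrete maximum principle

max-principle : ∀ {N} (z : Fin N → ℚ) (σ τ : Fin N → Fin N) {c} → 2ℚ ℚ.< c →
                (∀ i → z (σ i) + c · z i + z (τ i) ≡ 0ℚ) → ∀ i → z i ≡ 0ℚ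
max-principle {N} z σ τ {c} 2<c equation i =
  ℚₚ.∣p∣≡0⇒p≡0 (z i) (ℚₚ.≤-antisym (ℚₚ.≤-trans (below-max i) max≤0) (ℚₚ.0≤∣p∣ (z i)))
  where
  i₀ = argmax (∣_∣ ∘ z) i (allFin N)
  M  = ∣ z i₀ ∣

  below-max : ∀ k → ∣ z k ∣ ℚ.≤ M
  below-max k = lookup (f[xs]≤f[argmax] i (allFin N)) (∈-allFin k)

  ∣c∣≡c : ∣ c ∣ ≡ c
  ∣c∣≡c = ℚₚ.0≤p⇒∣p∣≡p (ℚₚ.<⇒≤ (ℚₚ.<-trans (ℚₚ.positive⁻¹ 2ℚ) 2<c))

  c-2-positive : ℚ.Positive (c - 2ℚ)
  c-2-positive = ℚ.positive (ℚₚ.+-monoˡ-< (- 2ℚ) 2<c)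

  isolate-centre : ∀ a b c → c ≡ - (a + b) + (a + c + b)
  isolate-centre = solve-∀ ℚ-ring

  centre : c · z i₀ ≡ - (z (σ i₀) + z (τ i₀))
  centre = by-vanishing (isolate-centre (z (σ i₀)) (z (τ i₀)) (c · z i₀)) (equation i₀)

  cM≤2M : c · M ℚ.≤ M + M
  cM≤2M = begin
    c · M                          ≡⟨ cong (_· M) ∣c∣≡c ⟨
    ∣ c ∣ · M                      ≡⟨ ℚₚ.∣p*q∣≡∣p∣*∣q∣ c (z i₀) ⟨
    ∣ c · z i₀ ∣                   ≡⟨ cong ∣_∣ centre ⟩
    ∣ - (z (σ i₀) + z (τ i₀)) ∣    ≡⟨ ℚₚ.∣-p∣≡∣p∣ _ ⟩
    ∣ z (σ i₀) + z (τ i₀) ∣        ≤⟨ ℚₚ.∣p+q∣≤∣p∣+∣q∣ (z (σ i₀)) (z (τ i₀)) ⟩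
    ∣ z (σ i₀) ∣ + ∣ z (τ i₀) ∣    ≤⟨ ℚₚ.+-mono-≤ (below-max (σ i₀)) (below-max (τ i₀)) ⟩
    M + M                          ∎
    where open ℚₚ.≤-Reasoning

  collect : ∀ c M → (c - 2ℚ) · M ≡ c · M - (M + M)
  collect = solve-∀ ℚ-ring

  max≤0 : M ℚ.≤ 0ℚ
  max≤0 = ℚₚ.*-cancelˡ-≤-pos (c - 2ℚ) {{c-2-positive}} (begin
    (c - 2ℚ) · M          ≡⟨ collect c M ⟩
    c · M - (M + M)       ≤⟨ ℚₚ.+-monoˡ-≤ (- (M + M)) cM≤2M ⟩
    (M + M) - (M + M)     ≡⟨ ℚₚ.+-inverseʳ (M + M) ⟩
    0ℚ                    ≡⟨ ℚₚ.*-zeroʳ (c - 2ℚ) ⟨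
    (c - 2ℚ) · 0ℚ         ∎)
    where open ℚₚ.≤-Reasoning

-- Translations of ℤ_n = Fin n

module Cyclic (n : ℕ) .{{_ : NonZero n}} where

  open ≡-Reasoning

  infixl 6 _⊞_ _⊟_

  _⊞_ : Fin n → ℕ → Fin n
  _⊞_ = _⊕_ n

  _⊟_ : Fin n → ℕ → Fin n
  j ⊟ a = j ⊞ (n ∸ a)

  toℕ-⊞ : ∀ j a → toℕ (j ⊞ a) ≡ (toℕ j ℕ.+ a) % n
  toℕ-⊞ j a = Finₚ.toℕ-fromℕ< _

  ⊞-cong : ∀ j {a b} → a % n ≡ b % n → j ⊞ a ≡ j ⊞ b
  ⊞-cong j {a} {b} a≡b = Finₚ.toℕ-injective (begin
    toℕ (j ⊞ a)             ≡⟨ toℕ-⊞ j a ⟩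
    (t ℕ.+ a) % n           ≡⟨ %-distribˡ-+ t a n ⟩
    (t % n ℕ.+ a % n) % n   ≡⟨ cong (λ r → (t % n ℕ.+ r) % n) a≡b ⟩
    (t % n ℕ.+ b % n) % n   ≡⟨ %-distribˡ-+ t b n ⟨
    (t ℕ.+ b) % n           ≡⟨ toℕ-⊞ j b ⟨
    toℕ (j ⊞ b)             ∎)
    where t = toℕ j

  ⊞-assoc : ∀ j a b → j ⊞ a ⊞ b ≡ j ⊞ (a ℕ.+ b)
  ⊞-assoc j a b = Finₚ.toℕ-injective (begin
    toℕ (j ⊞ a ⊞ b)                    ≡⟨ toℕ-⊞ (j ⊞ a) b ⟩
    (toℕ (j ⊞ a) ℕ.+ b) % n            ≡⟨ cong (λ r → (r ℕ.+ b) % n) (toℕ-⊞ j a) ⟩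
    ((t ℕ.+ a) % n ℕ.+ b) % n          ≡⟨ %-distribˡ-+ ((t ℕ.+ a) % n) b n ⟩
    ((t ℕ.+ a) % n % n ℕ.+ b % n) % n  ≡⟨ cong (λ r → (r ℕ.+ b % n) % n) (m%n%n≡m%n (t ℕ.+ a) n) ⟩
    ((t ℕ.+ a) % n ℕ.+ b % n) % n      ≡⟨ %-distribˡ-+ (t ℕ.+ a) b n ⟨
    (t ℕ.+ a ℕ.+ b) % n                ≡⟨ cong (_% n) (ℕₚ.+-assoc t a b) ⟩
    (t ℕ.+ (a ℕ.+ b)) % n              ≡⟨ toℕ-⊞ j (a ℕ.+ b) ⟨
    toℕ (j ⊞ (a ℕ.+ b))                ∎)
    where t = toℕ j

  ⊞-comm : ∀ j a b → j ⊞ a ⊞ b ≡ j ⊞ b ⊞ a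
  ⊞-comm j a b = begin
    j ⊞ a ⊞ b          ≡⟨ ⊞-assoc j a b ⟩
    j ⊞ (a ℕ.+ b)      ≡⟨ cong (j ⊞_) (ℕₚ.+-comm a b) ⟩
    j ⊞ (b ℕ.+ a)      ≡⟨ ⊞-assoc j b a ⟨
    j ⊞ b ⊞ a          ∎

  ⊞-period : ∀ j {a} → n ∣ a → j ⊞ a ≡ j
  ⊞-period j {a} n∣a = Finₚ.toℕ-injective (begin
    toℕ (j ⊞ a)        ≡⟨ toℕ-⊞ j a ⟩
    (toℕ j ℕ.+ a) % n  ≡⟨ %-remove-+ʳ (toℕ j) n∣a ⟩
    toℕ j % n          ≡⟨ m<n⇒m%n≡m (Finₚ.toℕ<n j) ⟩
    toℕ j              ∎)

  ⊞-zero : ∀ j → j ⊞ 0 ≡ j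
  ⊞-zero j = ⊞-period j (divides 0 refl)

  ⊟-⊞ : ∀ {a} → a ≤ n → ∀ j → j ⊟ a ⊞ a ≡ j
  ⊟-⊞ {a} a≤n j = trans (⊞-assoc j (n ∸ a) a) (⊞-period j (∣-reflexive (sym (ℕₚ.m∸n+n≡m a≤n))))

  ⊞-⊟ : ∀ {a} → a ≤ n → ∀ j → j ⊞ a ⊟ a ≡ j
  ⊞-⊟ {a} a≤n j = trans (⊞-assoc j a (n ∸ a)) (⊞-period j (∣-reflexive (sym (ℕₚ.m+[n∸m]≡n a≤n))))

  ⊞-≢ : ∀ j {a} → 0 < a → a < n → j ⊞ a ≢ j
  ⊞-≢ j {a} 0<a a<n j⊞a≡j = ℕₚ.<⇒≱ a<n (∣⇒≤ {{ℕ.>-nonZero 0<a}} (divides q a≡q*n))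
    where
    t = toℕ j
    q = (t ℕ.+ a) / n
    a≡q*n : a ≡ q * n
    a≡q*n = ℕₚ.+-cancelˡ-≡ t _ _ (begin
      t ℕ.+ a                  ≡⟨ m≡m%n+[m/n]*n (t ℕ.+ a) n ⟩
      (t ℕ.+ a) % n ℕ.+ q * n  ≡⟨ cong (ℕ._+ q * n) (trans (sym (toℕ-⊞ j a)) (cong toℕ j⊞a≡j)) ⟩
      t ℕ.+ q * n              ∎)

  ⊞-involutive : ∀ {h} → n ∣ h ℕ.+ h → ∀ j → j ⊞ h ⊞ h ≡ j
  ⊞-involutive {h} n∣h+h j = trans (⊞-assoc j h h) (⊞-period j n∣h+h)

  ⊞-conjugate : ∀ {h} → n ∣ h ℕ.+ h → ∀ j b → j ⊞ h ⊞ b ⊞ h ≡ j ⊞ b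
  ⊞-conjugate {h} n∣h+h j b = trans (⊞-comm (j ⊞ h) b h) (cong (_⊞ b) (⊞-involutive n∣h+h j))

  eqB-sound : ∀ x y → T (eqB n x y) → x ≡ y
  eqB-sound x y = toWitness {a? = x Finₚ.≟ y}

  eqB-complete : ∀ x y → x ≡ y → T (eqB n x y)
  eqB-complete x y = fromWitness {a? = x Finₚ.≟ y}

  eqB-false : ∀ {x y} → x ≢ y → eqB n x y ≡ false
  eqB-false {x} {y} x≢y = trans (isYes≗does (x Finₚ.≟ y)) (dec-false (x Finₚ.≟ y) x≢y)

  origin : Fin n
  origin = fromℕ< (ℕ.>-nonZero⁻¹ n)

  origin-⊞ : ∀ j → origin ⊞ toℕ j ≡ j
  origin-⊞ j = Finₚ.toℕ-injective (begin
    toℕ (origin ⊞ toℕ j)        ≡⟨ toℕ-⊞ origin (toℕ j) ⟩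
    (toℕ origin ℕ.+ toℕ j) % n  ≡⟨ cong (λ r → (r ℕ.+ toℕ j) % n) (Finₚ.toℕ-fromℕ< _) ⟩
    toℕ j % n                   ≡⟨ m<n⇒m%n≡m (Finₚ.toℕ<n j) ⟩
    toℕ j                       ∎)

  iterate-invariant : ∀ (z : Fin n → ℚ) {a} → (∀ j → z (j ⊞ a) ≡ z j) →
                      ∀ i j → z (j ⊞ (i * a)) ≡ z j
  iterate-invariant z     invariant zero    j = cong z (⊞-zero j)
  iterate-invariant z {a} invariant (suc i) j = begin
    z (j ⊞ (suc i * a))    ≡⟨ cong z (⊞-assoc j a (i * a)) ⟨
    z (j ⊞ a ⊞ (i * a))    ≡⟨ iterate-invariant z invariant i (j ⊞ a) ⟩
    z (j ⊞ a)              ≡⟨ invariant j ⟩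
    z j                    ∎

  iterate-anti-invariant : ∀ (z : Fin n → ℚ) {a} → (∀ j → z (j ⊞ a) ≡ - z j) →
                           ∀ i j → z (j ⊞ (i * a)) ≡ sign i · z j
  iterate-anti-invariant z     anti zero    j = trans (cong z (⊞-zero j)) (sym (ℚₚ.*-identityˡ (z j)))
  iterate-anti-invariant z {a} anti (suc i) j = begin
    z (j ⊞ (suc i * a))    ≡⟨ cong z (⊞-assoc j a (i * a)) ⟨
    z (j ⊞ a ⊞ (i * a))    ≡⟨ iterate-anti-invariant z anti i (j ⊞ a) ⟩
    sign i · z (j ⊞ a)     ≡⟨ cong (sign i ·_) (anti j) ⟩
    sign i · - z j         ≡⟨ ℚₚ.neg-distribʳ-* (sign i) (z j) ⟨
    - (sign i · z j)       ≡⟨ ℚₚ.neg-distribˡ-* (sign i) (z j) ⟩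
    sign (suc i) · z j     ∎

  iterate-growth : ∀ (z g : Fin n → ℚ) {a} → (∀ j → g (j ⊞ a) ≡ g j) → (∀ j → z (j ⊞ a) ≡ z j + g j) →
                   ∀ i j → z (j ⊞ (i * a)) ≡ z j + i ×ₘ g j
  iterate-growth z g     invariant step zero    j = trans (cong z (⊞-zero j)) (sym (ℚₚ.+-identityʳ (z j)))
  iterate-growth z g {a} invariant step (suc i) j = begin
    z (j ⊞ (suc i * a))            ≡⟨ cong z (⊞-assoc j a (i * a)) ⟨
    z (j ⊞ a ⊞ (i * a))            ≡⟨ iterate-growth z g invariant step i (j ⊞ a) ⟩
    z (j ⊞ a) + i ×ₘ g (j ⊞ a)     ≡⟨ cong₂ (λ s t → s + i ×ₘ t) (step j) (invariant j) ⟩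
    z j + g j + i ×ₘ g j           ≡⟨ ℚₚ.+-assoc (z j) (g j) (i ×ₘ g j) ⟩
    z j + suc i ×ₘ g j             ∎

  anti-invariant⇒zero : ∀ (z : Fin n → ℚ) {a} k → n ∣ suc (k * 2) * a →
                        (∀ j → z (j ⊞ a) ≡ - z j) → ∀ j → z j ≡ 0ℚ
  anti-invariant⇒zero z {a} k n∣order anti j = x≡-x⇒x≡0 (begin
    z j                          ≡⟨ cong z (⊞-period j n∣order) ⟨
    z (j ⊞ (suc (k * 2) * a))    ≡⟨ iterate-anti-invariant z anti (suc (k * 2)) j ⟩
    sign (suc (k * 2)) · z j     ≡⟨ cong (_· z j) (sign-odd k) ⟩
    - 1ℚ · z j                   ≡⟨ ℚₚ.neg-distribˡ-* 1ℚ (z j) ⟨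
    - (1ℚ · z j)                 ≡⟨ cong -_ (ℚₚ.*-identityˡ (z j)) ⟩
    - z j                        ∎)

  Recurrence : ℕ → ℚ → (Fin n → ℚ) → Set
  Recurrence a c z = ∀ j → z (j ⊟ a) + c · z j + z (j ⊞ a) ≡ 0ℚ

  recurrence-forward : ∀ {a} c z → a ≤ n → Recurrence a c z →
                       ∀ j → z j + c · z (j ⊞ a) + z (j ⊞ a ⊞ a) ≡ 0ℚ
  recurrence-forward {a} c z a≤n recurrence j =
    trans (cong (λ i → z i + c · z (j ⊞ a) + z (j ⊞ a ⊞ a)) (sym (⊞-⊟ a≤n j))) (recurrence (j ⊞ a))

  recurrence-0⇒zero : ∀ {a} z k → a ≤ n → n ∣ suc (k * 2) * a → Recurrence a 0ℚ z → ∀ j → z j ≡ 0ℚ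
  recurrence-0⇒zero {a} z k a≤n n∣order recurrence = anti-invariant⇒zero z k n∣double-order anti
    where
    n∣double-order : n ∣ suc (k * 2) * (a ℕ.+ a)
    n∣double-order = subst (n ∣_) (sym (ℕₚ.*-distribˡ-+ (suc (k * 2)) a a)) (∣m∣n⇒∣m+n n∣order n∣order)
    solve-last : ∀ p q r → r ≡ - p + (p + 0ℚ · q + r)
    solve-last = solve-∀ ℚ-ring
    anti : ∀ j → z (j ⊞ (a ℕ.+ a)) ≡ - z j
    anti j = trans (cong z (sym (⊞-assoc j a a)))
                   (by-vanishing (solve-last (z j) (z (j ⊞ a)) (z (j ⊞ a ⊞ a)))
                                 (recurrence-forward 0ℚ z a≤n recurrence j))

  recurrence-2⇒zero : ∀ {a} z k → a ≤ n → n ∣ suc (k * 2) * a → Recurrence a 2ℚ z → ∀ j → z j ≡ 0ℚ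
  recurrence-2⇒zero {a} z k a≤n n∣order recurrence = anti-invariant⇒zero z k n∣order z-anti
    where
    g : Fin n → ℚ
    g j = z j + z (j ⊞ a)
    g-identity : ∀ p q r → q + r ≡ - (p + q) + (p + 2ℚ · q + r)
    g-identity = solve-∀ ℚ-ring
    g-anti : ∀ j → g (j ⊞ a) ≡ - g j
    g-anti j = by-vanishing (g-identity (z j) (z (j ⊞ a)) (z (j ⊞ a ⊞ a)))
                            (recurrence-forward 2ℚ z a≤n recurrence j)
    z-identity : ∀ p q → q ≡ - p + (p + q)
    z-identity = solve-∀ ℚ-ring
    z-anti : ∀ j → z (j ⊞ a) ≡ - z j
    z-anti j = by-vanishing (z-identity (z j) (z (j ⊞ a))) (anti-invariant⇒zero g k n∣order g-anti j)

  harmonic⇒invariant : ∀ {a} z → a ≤ n → Recurrence a (- 2ℚ) z → ∀ j → z (j ⊞ a) ≡ z j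
  harmonic⇒invariant {a} z a≤n recurrence j = by-vanishing (step j) (g-zero j)
    where
    g : Fin n → ℚ
    g j = z (j ⊞ a) - z j
    g-identity : ∀ p q r → r - q ≡ (q - p) + (p + - 2ℚ · q + r)
    g-identity = solve-∀ ℚ-ring
    g-invariant : ∀ j → g (j ⊞ a) ≡ g j
    g-invariant j = by-vanishing (g-identity (z j) (z (j ⊞ a)) (z (j ⊞ a ⊞ a)))
                                 (recurrence-forward (- 2ℚ) z a≤n recurrence j)
    step-identity : ∀ p q → q ≡ p + (q - p)
    step-identity = solve-∀ ℚ-ring
    step : ∀ j → z (j ⊞ a) ≡ z j + g j
    step j = step-identity (z j) (z (j ⊞ a))
    cancel-identity : ∀ p q → q ≡ (p + q) - p
    cancel-identity = solve-∀ ℚ-ring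
    g-zero : ∀ j → g j ≡ 0ℚ
    g-zero j = ×ₘ-cancel n (begin
      n ×ₘ g j                  ≡⟨ cancel-identity (z j) (n ×ₘ g j) ⟩
      (z j + n ×ₘ g j) - z j    ≡⟨ cong (_- z j) (iterate-growth z g g-invariant step n j) ⟨
      z (j ⊞ (n * a)) - z j     ≡⟨ cong (λ i → z i - z j) (⊞-period j (m∣m*n a)) ⟩
      z j - z j                 ≡⟨ ℚₚ.+-inverseʳ (z j) ⟩
      0ℚ                        ∎)

  dominant⇒zero : ∀ {c} a z → 2ℚ ℚ.< c → Recurrence a c z → ∀ j → z j ≡ 0ℚ
  dominant⇒zero a z = max-principle z (_⊟ a) (_⊞ a)

  module Twisted {h : ℕ} (n∣h+h : n ∣ h ℕ.+ h) {a : ℕ} (z : Fin n → ℚ) (c : ℚ)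
                 (twisted : ∀ j → z (j ⊟ a ⊞ h) + z (j ⊞ h) + z (j ⊞ a ⊞ h) + c · z j ≡ 0ℚ) where

    twisted-antipode : ∀ j → z (j ⊟ a) + z j + z (j ⊞ a) + c · z (j ⊞ h) ≡ 0ℚ
    twisted-antipode j = trans (cong (_+ c · z (j ⊞ h)) (sym shifts)) (twisted (j ⊞ h))
      where
      conjugate : ∀ b → z (j ⊞ h ⊞ b ⊞ h) ≡ z (j ⊞ b)
      conjugate b = cong z (⊞-conjugate n∣h+h j b)
      shifts : z (j ⊞ h ⊟ a ⊞ h) + z (j ⊞ h ⊞ h) + z (j ⊞ h ⊞ a ⊞ h) ≡ z (j ⊟ a) + z j + z (j ⊞ a)
      shifts = cong₂ _+_ (cong₂ _+_ (conjugate (n ∸ a)) (cong z (⊞-involutive n∣h+h j))) (conjugate a)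

    even-part : Fin n → ℚ
    even-part j = z j + z (j ⊞ h)

    odd-part : Fin n → ℚ
    odd-part j = z j - z (j ⊞ h)

    even-part-recurrence : Recurrence a (1ℚ + c) even-part
    even-part-recurrence j =
      by-vanishing (identity (z (j ⊟ a)) (z j) (z (j ⊞ a)) (z (j ⊟ a ⊞ h)) (z (j ⊞ h)) (z (j ⊞ a ⊞ h)) c)
                   (cong₂ _+_ (twisted j) (twisted-antipode j))
      where
      identity : ∀ A B C D E F c → A + D + (1ℚ + c) · (B + E) + (C + F)
                                 ≡ 0ℚ + ((D + E + F + c · B) + (A + B + C + c · E))
      identity = solve-∀ ℚ-ring

    odd-part-recurrence : Recurrence a (1ℚ - c) odd-part
    odd-part-recurrence j =
      by-vanishing (identity (z (j ⊟ a)) (z j) (z (j ⊞ a)) (z (j ⊟ a ⊞ h)) (z (j ⊞ h)) (z (j ⊞ a ⊞ h)) c)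
                   (cong₂ _-_ (twisted-antipode j) (twisted j))
      where
      identity : ∀ A B C D E F c → (A - D) + (1ℚ - c) · (B - E) + (C - F)
                                 ≡ 0ℚ + ((A + B + C + c · E) - (D + E + F + c · B))
      identity = solve-∀ ℚ-ring

-- The graph G⁽¹¹⁾(n; 2, 2) for n = 2h, h = 2k + 1

module Graph (n : ℕ) .{{_ : NonZero n}} (k : ℕ) (n≡h*2 : n ≡ suc (k * 2) * 2) (2<n : 2 < n) where

  open Cyclic n
  open ≡-Reasoning

  h : ℕ
  h = suc (k * 2)

  n∣h+h : n ∣ h ℕ.+ h
  n∣h+h = ∣-reflexive (trans n≡h*2 (trans (ℕₚ.*-comm h 2) (cong (h ℕ.+_) (ℕₚ.+-identityʳ h))))

  n∣h*2 : n ∣ h * 2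
  n∣h*2 = ∣-reflexive n≡h*2

  2≤n : 2 ≤ n
  2≤n = ℕₚ.<⇒≤ 2<n

  ⊞h-involutive : ∀ j → j ⊞ h ⊞ h ≡ j
  ⊞h-involutive = ⊞-involutive n∣h+h

  ⊕-red-2 : ∀ j → _⊕_ n j (red n (+ 2)) ≡ j ⊞ 2
  ⊕-red-2 j = ⊞-cong j (m%n%n≡m%n 2 n)

  ⊕-half : ∀ j → _⊕_ n j (n / 2) ≡ j ⊞ h
  ⊕-half j = cong (j ⊞_) (trans (/-congˡ n≡h*2) (m*n/n≡m h 2))

  ⊞2-≢ : ∀ j → j ≢ j ⊞ 2
  ⊞2-≢ j = ⊞-≢ j (s≤s z≤n) 2<n ∘ sym

  ⊟2-≢ : ∀ j → j ≢ j ⊟ 2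
  ⊟2-≢ j j≡j⊟2 = ⊞2-≢ j (sym (trans (cong (_⊞ 2) j≡j⊟2) (⊟-⊞ 2≤n j)))

  not-antipodal : ∀ j → j ≢ _⊕_ n j (n / 2)
  not-antipodal j j≡ = ⊞-≢ j (s≤s z≤n) h<n (sym (trans j≡ (⊕-half j)))
    where
    h<n : h < n
    h<n = subst (h <_) (sym n≡h*2) (ℕₚ.m<m*n h 2 (s≤s (s≤s z≤n)))

  adj : Cls × Fin n → Cls × Fin n → Bool
  adj p q = gen n (+ 2) (+ 2) p q ∨ gen n (+ 2) (+ 2) q p

  -- The shapes to which adj (X , j) (Y , k) reduces for concrete classes X and Y.
  module Cell where

    none : sumFin n (λ _ → 0ℚ) ≡ 0ℚ
    none = sumFin-zero n (λ _ → refl)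

    forward : ∀ {u} j → sumFin n (λ k → when (eqB n k j ∨ false) (u k)) ≡ u j
    forward {u} j =
      sumFin-when-point (λ k → eqB n k j ∨ false) u
        (λ k → [ eqB-sound k j , (λ ()) ]′ ∘ ∨-elim (eqB n k j))
        (∨-introˡ (eqB-complete j j refl))

    backward : ∀ {u} j → sumFin n (λ k → when (eqB n j k) (u k)) ≡ u j
    backward {u} j = sumFin-when-point (eqB n j) u (λ k → sym ∘ eqB-sound j k) (eqB-complete j j refl)

    forward-pair : ∀ {u} j →
      sumFin n (λ k → when ((eqB n k j ∨ eqB n k (_⊕_ n j (red n (+ 2)))) ∨ false) (u k)) ≡ u j + u (j ⊞ 2)
    forward-pair {u} j =
      sumFin-when-two-points (λ k → (eqB n k j ∨ eqB n k (_⊕_ n j (red n (+ 2)))) ∨ false) u (⊞2-≢ j)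
        (λ k → [ [ inj₁ ∘ eqB-sound k j , inj₂ ∘ shifted k ]′ ∘ ∨-elim (eqB n k j) , (λ ()) ]′
               ∘ ∨-elim (eqB n k j ∨ eqB n k (_⊕_ n j (red n (+ 2)))))
        (∨-introˡ (∨-introˡ (eqB-complete j j refl)))
        (∨-introˡ (∨-introʳ (eqB n (j ⊞ 2) j) (eqB-complete (j ⊞ 2) _ (sym (⊕-red-2 j)))))
      where
      shifted : ∀ k → T (eqB n k (_⊕_ n j (red n (+ 2)))) → k ≡ j ⊞ 2
      shifted k k≡ = trans (eqB-sound k _ k≡) (⊕-red-2 j)

    backward-pair : ∀ {u} j →
      sumFin n (λ k → when (eqB n j k ∨ eqB n j (_⊕_ n k (red n (+ 2)))) (u k)) ≡ u j + u (j ⊟ 2)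
    backward-pair {u} j =
      sumFin-when-two-points (λ k → eqB n j k ∨ eqB n j (_⊕_ n k (red n (+ 2)))) u (⊟2-≢ j)
        (λ k → [ inj₁ ∘ sym ∘ eqB-sound j k , inj₂ ∘ shifted-back k ]′ ∘ ∨-elim (eqB n j k))
        (∨-introˡ (eqB-complete j j refl))
        (∨-introʳ (eqB n j (j ⊟ 2)) (eqB-complete j _ (sym (trans (⊕-red-2 (j ⊟ 2)) (⊟-⊞ 2≤n j)))))
      where
      shifted-back : ∀ k → T (eqB n j (_⊕_ n k (red n (+ 2)))) → k ≡ j ⊟ 2
      shifted-back k j≡ = trans (sym (⊞-⊟ 2≤n k)) (cong (_⊟ 2) (sym (trans (eqB-sound j _ j≡) (⊕-red-2 k))))

    antipodal : ∀ {u} j →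
      sumFin n (λ k → when (eqB n k (_⊕_ n j (n / 2)) ∨ eqB n j (_⊕_ n k (n / 2))) (u k)) ≡ u (j ⊞ h)
    antipodal {u} j =
      sumFin-when-point (λ k → eqB n k (_⊕_ n j (n / 2)) ∨ eqB n j (_⊕_ n k (n / 2))) u
        (λ k → [ (λ k≡ → trans (eqB-sound k _ k≡) (⊕-half j)) , antipode k ]′ ∘ ∨-elim (eqB n k (_⊕_ n j (n / 2))))
        (∨-introˡ (eqB-complete (j ⊞ h) _ (sym (⊕-half j))))
      where
      antipode : ∀ k → T (eqB n j (_⊕_ n k (n / 2))) → k ≡ j ⊞ h
      antipode k j≡ = trans (sym (⊞h-involutive k)) (cong (_⊞ h) (sym (trans (eqB-sound j _ j≡) (⊕-half k))))

  adjacency : (Cls → Fin n → ℚ) → Cls → Fin n → ℚ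
  adjacency z a'  j = z a'' j + (z b' j + z b' (j ⊞ 2))
  adjacency z a'' j = z a' j + (z b'' j + z b'' (j ⊞ 2))
  adjacency z b'  j = z a' j + z a' (j ⊟ 2) + z c' j
  adjacency z b'' j = z a'' j + z a'' (j ⊟ 2) + z c'' j
  adjacency z c'  j = z b' j + (z c' (j ⊞ h) + z d' j)
  adjacency z c'' j = z b'' j + (z c'' (j ⊞ h) + z d'' j)
  adjacency z d'  j = z c' j + (z d' (j ⊞ h) + z e' j)
  adjacency z d'' j = z c'' j + (z d'' (j ⊞ h) + z e'' j)
  adjacency z e'  j = z d' j + (z e'' j + z f j)
  adjacency z e'' j = z d'' j + (z e' j + z f j)
  adjacency z f   j = z e' j + (z e'' j + z f (j ⊞ h))

  neighbourSum : Cls × Fin n → (Cls → Fin n → ℚ) → ℚ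
  neighbourSum p z = sumFin 11 (λ c → sumFin n (λ k → when (adj p (cls c , k)) (z (cls c) k)))

  infixr 5 _◦_ _∙_ _▸_

  _◦_ : ∀ {a b c} → a ≡ 0ℚ → b ≡ c → a + b ≡ c
  _◦_ {c = c} a≡0 b≡c = trans (cong₂ _+_ a≡0 b≡c) (ℚₚ.+-identityˡ c)

  _∙_ : ∀ {a b x c} → a ≡ x → b ≡ c → a + b ≡ x + c
  _∙_ = cong₂ _+_

  _▸_ : ∀ {a b x} → a ≡ x → b ≡ 0ℚ → a + b ≡ x
  _▸_ {x = x} a≡x b≡0 = trans (cong₂ _+_ a≡x b≡0) (ℚₚ.+-identityʳ x)

  -- Each row lists the contributions of the classes a′ a″ b′ b″ c′ c″ d′ d″ e′ e″ f, in this order.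
  neighbourSum-adjacency : ∀ z X j → neighbourSum (X , j) z ≡ adjacency z X j
  neighbourSum-adjacency z X j = row X
    where
    open Cell
    row : ∀ X → neighbourSum (X , j) z ≡ adjacency z X j
    row a'  = none ◦ forward j ∙ forward-pair j ▸ none ◦ none ◦ none ◦ none ◦ none ◦ none ◦ none ◦ none ◦ refl
    row a'' = backward j ∙ none ◦ none ◦ forward-pair j ▸ none ◦ none ◦ none ◦ none ◦ none ◦ none ◦ none ◦ refl
    row b'  = backward-pair j ∙ none ◦ none ◦ none ◦ forward j ▸ none ◦ none ◦ none ◦ none ◦ none ◦ none ◦ refl
    row b'' = none ◦ backward-pair j ∙ none ◦ none ◦ none ◦ forward j ▸ none ◦ none ◦ none ◦ none ◦ none ◦ refl
    row c'  = none ◦ none ◦ backward j ∙ none ◦ antipodal j ∙ none ◦ forward j ▸ none ◦ none ◦ none ◦ none ◦ refl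
    row c'' = none ◦ none ◦ none ◦ backward j ∙ none ◦ antipodal j ∙ none ◦ forward j ▸ none ◦ none ◦ none ◦ refl
    row d'  = none ◦ none ◦ none ◦ none ◦ backward j ∙ none ◦ antipodal j ∙ none ◦ forward j ▸ none ◦ none ◦ refl
    row d'' = none ◦ none ◦ none ◦ none ◦ none ◦ backward j ∙ none ◦ antipodal j ∙ none ◦ forward j ▸ none ◦ refl
    row e'  = none ◦ none ◦ none ◦ none ◦ none ◦ none ◦ backward j ∙ none ◦ none ◦ forward j ∙ forward j ▸ refl
    row e'' = none ◦ none ◦ none ◦ none ◦ none ◦ none ◦ none ◦ backward j ∙ backward j ∙ none ◦ forward j ▸ refl
    row f   = none ◦ none ◦ none ◦ none ◦ none ◦ none ◦ none ◦ none ◦ backward j ∙ backward j ∙ antipodal j ▸ refl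

  G : Graph (11 * n)
  G = G11 n (+ 2) (+ 2)

  lift : (Cls → Fin n → ℚ) → Fin (11 * n) → ℚ
  lift z v = uncurry z (vtx n v)

  vtx-combine : ∀ c k → vtx n (combine c k) ≡ (cls c , k)
  vtx-combine c k = cong (λ (c′ , k′) → cls c′ , k′) (Finₚ.remQuot-combine c k)

  adjMatrix-lift : ∀ z i → sumFin (11 * n) (λ v → adjMatrix G i v · lift z v) ≡ uncurry (adjacency z) (vtx n i)
  adjMatrix-lift z i = begin
    sumFin (11 * n) (λ v → adjMatrix G i v · lift z v)
      ≡⟨ sumFin-combine 11 n _ ⟩
    sumFin 11 (λ c → sumFin n (λ k → adjMatrix G i (combine c k) · lift z (combine c k)))
      ≡⟨ sumFin-cong 11 (λ c → sumFin-cong n (summand c)) ⟩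
    neighbourSum (vtx n i) z
      ≡⟨ neighbourSum-adjacency z (proj₁ (vtx n i)) (proj₂ (vtx n i)) ⟩
    uncurry (adjacency z) (vtx n i) ∎
    where
    summand : ∀ c k → adjMatrix G i (combine c k) · lift z (combine c k)
                    ≡ when (adj (vtx n i) (cls c , k)) (z (cls c) k)
    summand c k = trans (indicator-when (adj (vtx n i) (vtx n (combine c k))) (lift z (combine c k)))
                        (cong (λ q → when (adj (vtx n i) q) (uncurry z q)) (vtx-combine c k))

  sign-mod : ∀ m → sign (m % n) ≡ sign m
  sign-mod m = begin
    sign (m % n)                          ≡⟨ ℚₚ.*-identityʳ (sign (m % n)) ⟨
    sign (m % n) · 1ℚ                     ≡⟨ cong (sign (m % n) ·_) (sign-*2 (q * h)) ⟨
    sign (m % n) · sign (q * h * 2)       ≡⟨ sign-+ (m % n) (q * h * 2) ⟨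
    sign (m % n ℕ.+ q * h * 2)            ≡⟨ cong (λ t → sign (m % n ℕ.+ t)) q*h*2≡q*n ⟩
    sign (m % n ℕ.+ q * n)                ≡⟨ cong sign (m≡m%n+[m/n]*n m n) ⟨
    sign m                                ∎
    where
    q = m / n
    q*h*2≡q*n : q * h * 2 ≡ q * n
    q*h*2≡q*n = trans (ℕₚ.*-assoc q h 2) (cong (q *_) (sym n≡h*2))

  alternating : Fin n → ℚ
  alternating j = sign (toℕ j)

  alternating-⊞ : ∀ j a → alternating (j ⊞ a) ≡ sign a · alternating j
  alternating-⊞ j a = begin
    sign (toℕ (j ⊞ a))         ≡⟨ cong sign (toℕ-⊞ j a) ⟩
    sign ((toℕ j ℕ.+ a) % n)   ≡⟨ sign-mod (toℕ j ℕ.+ a) ⟩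
    sign (toℕ j ℕ.+ a)         ≡⟨ sign-+ (toℕ j) a ⟩
    alternating j · sign a     ≡⟨ ℚₚ.*-comm (alternating j) (sign a) ⟩
    sign a · alternating j     ∎

  alternating-⊞2 : ∀ j → alternating (j ⊞ 2) ≡ alternating j
  alternating-⊞2 j = trans (alternating-⊞ j 2) (ℚₚ.*-identityˡ (alternating j))

  alternating-⊟2 : ∀ j → alternating (j ⊟ 2) ≡ alternating j
  alternating-⊟2 j = trans (sym (alternating-⊞2 (j ⊟ 2))) (cong alternating (⊟-⊞ 2≤n j))

  alternating-⊞h : ∀ j → alternating (j ⊞ h) ≡ - alternating j
  alternating-⊞h j = begin
    alternating (j ⊞ h)        ≡⟨ alternating-⊞ j h ⟩
    sign h · alternating j     ≡⟨ cong (_· alternating j) (sign-odd k) ⟩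
    - 1ℚ · alternating j       ≡⟨ ℚₚ.neg-distribˡ-* 1ℚ (alternating j) ⟨
    - (1ℚ · alternating j)     ≡⟨ cong -_ (ℚₚ.*-identityˡ (alternating j)) ⟩
    - alternating j            ∎

  coefficient : Cls → ℚ
  coefficient a'  = 2ℚ
  coefficient a'' = 2ℚ
  coefficient b'  = - 1ℚ
  coefficient b'' = - 1ℚ
  coefficient c'  = - 4ℚ
  coefficient c'' = - 4ℚ
  coefficient d'  = - 3ℚ
  coefficient d'' = - 3ℚ
  coefficient e'  = 1ℚ
  coefficient e'' = 1ℚ
  coefficient f   = 2ℚ

  nut-vector : Cls → Fin n → ℚ
  nut-vector X j = coefficient X · alternating j

  nut-vector-⊞2 : ∀ X j → nut-vector X (j ⊞ 2) ≡ coefficient X · alternating j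
  nut-vector-⊞2 X j = cong (coefficient X ·_) (alternating-⊞2 j)

  nut-vector-⊟2 : ∀ X j → nut-vector X (j ⊟ 2) ≡ coefficient X · alternating j
  nut-vector-⊟2 X j = cong (coefficient X ·_) (alternating-⊟2 j)

  nut-vector-⊞h : ∀ X j → nut-vector X (j ⊞ h) ≡ - coefficient X · alternating j
  nut-vector-⊞h X j = begin
    coefficient X · alternating (j ⊞ h)    ≡⟨ cong (coefficient X ·_) (alternating-⊞h j) ⟩
    coefficient X · - alternating j        ≡⟨ ℚₚ.neg-distribʳ-* (coefficient X) (alternating j) ⟨
    - (coefficient X · alternating j)      ≡⟨ ℚₚ.neg-distribˡ-* (coefficient X) (alternating j) ⟩
    - coefficient X · alternating j        ∎

  vanishes : ∀ s α β γ {p q r} → α + (β + γ) ≡ 0ℚ →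
             p ≡ α · s → q ≡ β · s → r ≡ γ · s → p + (q + r) ≡ 0ℚ
  vanishes s α β γ {p} {q} {r} α+β+γ≡0 p≡ q≡ r≡ = begin
    p + (q + r)                  ≡⟨ cong₂ _+_ p≡ (cong₂ _+_ q≡ r≡) ⟩
    α · s + (β · s + γ · s)      ≡⟨ cong (_+_ (α · s)) (ℚₚ.*-distribʳ-+ s β γ) ⟨
    α · s + (β + γ) · s          ≡⟨ ℚₚ.*-distribʳ-+ s α (β + γ) ⟨
    (α + (β + γ)) · s            ≡⟨ cong (_· s) α+β+γ≡0 ⟩
    0ℚ · s                       ≡⟨ ℚₚ.*-zeroˡ s ⟩
    0ℚ                           ∎

  nut-vector-kernel : ∀ X j → adjacency nut-vector X j ≡ 0ℚ
  nut-vector-kernel a'  j = vanishes (alternating j) 2ℚ (- 1ℚ) (- 1ℚ) refl refl refl (nut-vector-⊞2 b' j)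
  nut-vector-kernel a'' j = vanishes (alternating j) 2ℚ (- 1ℚ) (- 1ℚ) refl refl refl (nut-vector-⊞2 b'' j)
  nut-vector-kernel b'  j = trans (ℚₚ.+-assoc (nut-vector a' j) _ _)
                                  (vanishes (alternating j) 2ℚ 2ℚ (- 4ℚ) refl refl (nut-vector-⊟2 a' j) refl)
  nut-vector-kernel b'' j = trans (ℚₚ.+-assoc (nut-vector a'' j) _ _)
                                  (vanishes (alternating j) 2ℚ 2ℚ (- 4ℚ) refl refl (nut-vector-⊟2 a'' j) refl)
  nut-vector-kernel c'  j = vanishes (alternating j) (- 1ℚ) 4ℚ (- 3ℚ) refl refl (nut-vector-⊞h c' j) refl
  nut-vector-kernel c'' j = vanishes (alternating j) (- 1ℚ) 4ℚ (- 3ℚ) refl refl (nut-vector-⊞h c'' j) refl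
  nut-vector-kernel d'  j = vanishes (alternating j) (- 4ℚ) 3ℚ 1ℚ refl refl (nut-vector-⊞h d' j) refl
  nut-vector-kernel d'' j = vanishes (alternating j) (- 4ℚ) 3ℚ 1ℚ refl refl (nut-vector-⊞h d'' j) refl
  nut-vector-kernel e'  j = vanishes (alternating j) (- 3ℚ) 1ℚ 2ℚ refl refl refl refl
  nut-vector-kernel e'' j = vanishes (alternating j) (- 3ℚ) 1ℚ 2ℚ refl refl refl refl
  nut-vector-kernel f   j = vanishes (alternating j) 1ℚ 1ℚ (- 2ℚ) refl refl refl (nut-vector-⊞h f j)

  coefficient-nonzero : ∀ X → coefficient X ≢ 0ℚ
  coefficient-nonzero a'  ()
  coefficient-nonzero a'' ()
  coefficient-nonzero b'  ()
  coefficient-nonzero b'' ()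
  coefficient-nonzero c'  ()
  coefficient-nonzero c'' ()
  coefficient-nonzero d'  ()
  coefficient-nonzero d'' ()
  coefficient-nonzero e'  ()
  coefficient-nonzero e'' ()
  coefficient-nonzero f   ()

  nut-vector-nonzero : ∀ X j → nut-vector X j ≢ 0ℚ
  nut-vector-nonzero X j v≡0 = coefficient-nonzero X (begin
    coefficient X                                     ≡⟨ ℚₚ.*-identityʳ (coefficient X) ⟨
    coefficient X · 1ℚ                                ≡⟨ cong (coefficient X ·_) (sign-squared (toℕ j)) ⟨
    coefficient X · (alternating j · alternating j)   ≡⟨ ℚₚ.*-assoc (coefficient X) _ _ ⟨
    nut-vector X j · alternating j                    ≡⟨ cong (_· alternating j) v≡0 ⟩
    0ℚ · alternating j                                ≡⟨ ℚₚ.*-zeroˡ (alternating j) ⟩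
    0ℚ                                                ∎)

  swap : Cls → Cls
  swap a'  = a''
  swap a'' = a'
  swap b'  = b''
  swap b'' = b'
  swap c'  = c''
  swap c'' = c'
  swap d'  = d''
  swap d'' = d'
  swap e'  = e''
  swap e'' = e'
  swap f   = f

  adjacency-swap : ∀ z X j → adjacency (z ∘ swap) X j ≡ adjacency z (swap X) j
  adjacency-swap z a'  j = refl
  adjacency-swap z a'' j = refl
  adjacency-swap z b'  j = refl
  adjacency-swap z b'' j = refl
  adjacency-swap z c'  j = refl
  adjacency-swap z c'' j = refl
  adjacency-swap z d'  j = refl
  adjacency-swap z d'' j = refl
  adjacency-swap z e'  j = refl
  adjacency-swap z e'' j = refl
  adjacency-swap z f   j = exchange (z e'' j) (z e' j) (z f (j ⊞ h))
    where
    exchange : ∀ p q r → p + (q + r) ≡ q + (p + r)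
    exchange = solve-∀ ℚ-ring

  swap-kernel : ∀ z → (∀ X j → adjacency z X j ≡ 0ℚ) → ∀ X j → adjacency (z ∘ swap) X j ≡ 0ℚ
  swap-kernel z kernel X j = trans (adjacency-swap z X j) (kernel (swap X) j)

  module Substitution (z : Cls → Fin n → ℚ) (kernel : ∀ X j → adjacency z X j ≡ 0ℚ) where

    x y : Fin n → ℚ
    x = z e'
    y = z e''

    f-sub : ∀ j → z f j ≡ - (x (j ⊞ h) + y (j ⊞ h))
    f-sub j = begin
      z f j                        ≡⟨ cong (z f) (⊞h-involutive j) ⟨
      z f (j ⊞ h ⊞ h)              ≡⟨ isolateʳ (x (j ⊞ h)) (y (j ⊞ h)) (kernel f (j ⊞ h)) ⟩
      - (x (j ⊞ h) + y (j ⊞ h))    ∎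

    d'-sub : ∀ j → z d' j ≡ x (j ⊞ h) + y (j ⊞ h) - y j
    d'-sub j = begin
      z d' j                                ≡⟨ isolateˡ (y j) (z f j) (kernel e' j) ⟩
      - (y j + z f j)                       ≡⟨ cong (λ t → - (y j + t)) (f-sub j) ⟩
      - (y j + - (x (j ⊞ h) + y (j ⊞ h)))   ≡⟨ rearrange (x (j ⊞ h)) (y (j ⊞ h)) (y j) ⟩
      x (j ⊞ h) + y (j ⊞ h) - y j           ∎
      where
      rearrange : ∀ p q r → - (r + - (p + q)) ≡ p + q - r
      rearrange = solve-∀ ℚ-ring

    c'-sub : ∀ j → z c' j ≡ y (j ⊞ h) - 2ℚ · x j - y j
    c'-sub j = begin
      z c' j                                               ≡⟨ isolateˡ (z d' (j ⊞ h)) (x j) (kernel d' j) ⟩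
      - (z d' (j ⊞ h) + x j)                               ≡⟨ cong (λ t → - (t + x j)) (d'-sub (j ⊞ h)) ⟩
      - (x (j ⊞ h ⊞ h) + y (j ⊞ h ⊞ h) - y (j ⊞ h) + x j)  ≡⟨ cong (λ i → - (x i + y i - y (j ⊞ h) + x j))
                                                                   (⊞h-involutive j) ⟩
      - (x j + y j - y (j ⊞ h) + x j)                      ≡⟨ rearrange (x j) (y j) (y (j ⊞ h)) ⟩
      y (j ⊞ h) - 2ℚ · x j - y j                           ∎
      where
      rearrange : ∀ p q r → - (p + q - r + p) ≡ r - 2ℚ · p - q
      rearrange = solve-∀ ℚ-ring

    b'-sub : ∀ j → z b' j ≡ x (j ⊞ h)
    b'-sub j = begin
      z b' j                                              ≡⟨ isolateˡ (z c' (j ⊞ h)) (z d' j) (kernel c' j) ⟩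
      - (z c' (j ⊞ h) + z d' j)                           ≡⟨ cong₂ (λ s t → - (s + t)) (c'-sub (j ⊞ h)) (d'-sub j) ⟩
      - (y (j ⊞ h ⊞ h) - 2ℚ · x′ - y′ + (x′ + y′ - y j))  ≡⟨ cong (λ i → - (y i - 2ℚ · x′ - y′ + (x′ + y′ - y j)))
                                                                 (⊞h-involutive j) ⟩
      - (y j - 2ℚ · x′ - y′ + (x′ + y′ - y j))            ≡⟨ rearrange x′ y′ (y j) ⟩
      x′                                                  ∎
      where
      x′ = x (j ⊞ h)
      y′ = y (j ⊞ h)
      rearrange : ∀ p q r → - (r - 2ℚ · p - q + (p + q - r)) ≡ p
      rearrange = solve-∀ ℚ-ring

    a''-sub : ∀ j → z a'' j ≡ - (x (j ⊞ h) + x (j ⊞ 2 ⊞ h))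
    a''-sub j = trans (isolateˡ (z b' j) (z b' (j ⊞ 2)) (kernel a' j))
                      (cong₂ (λ s t → - (s + t)) (b'-sub j) (b'-sub (j ⊞ 2)))

    module Values (e : Fin n → ℚ) (x≗e : ∀ j → x j ≡ e j) (y≗e : ∀ j → y j ≡ e j)
                  (e-⊞2 : ∀ j → e (j ⊞ 2) ≡ e j) (e-⊞h : ∀ j → e (j ⊞ h) ≡ - e j) where

      xᴴ : ∀ j → x (j ⊞ h) ≡ - e j
      xᴴ j = trans (x≗e (j ⊞ h)) (e-⊞h j)

      yᴴ : ∀ j → y (j ⊞ h) ≡ - e j
      yᴴ j = trans (y≗e (j ⊞ h)) (e-⊞h j)

      f-value : ∀ j → z f j ≡ 2ℚ · e j
      f-value j = begin
        z f j                      ≡⟨ f-sub j ⟩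
        - (x (j ⊞ h) + y (j ⊞ h))  ≡⟨ cong₂ (λ s t → - (s + t)) (xᴴ j) (yᴴ j) ⟩
        - (- e j + - e j)          ≡⟨ rearrange (e j) ⟩
        2ℚ · e j                   ∎
        where
        rearrange : ∀ p → - (- p + - p) ≡ 2ℚ · p
        rearrange = solve-∀ ℚ-ring

      d'-value : ∀ j → z d' j ≡ - 3ℚ · e j
      d'-value j = begin
        z d' j                       ≡⟨ d'-sub j ⟩
        x (j ⊞ h) + y (j ⊞ h) - y j  ≡⟨ cong₂ _-_ (cong₂ _+_ (xᴴ j) (yᴴ j)) (y≗e j) ⟩
        - e j + - e j - e j          ≡⟨ rearrange (e j) ⟩
        - 3ℚ · e j                   ∎
        where
        rearrange : ∀ p → - p + - p - p ≡ - 3ℚ · p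
        rearrange = solve-∀ ℚ-ring

      c'-value : ∀ j → z c' j ≡ - 4ℚ · e j
      c'-value j = begin
        z c' j                       ≡⟨ c'-sub j ⟩
        y (j ⊞ h) - 2ℚ · x j - y j   ≡⟨ cong₂ _-_ (cong₂ (λ s t → s - 2ℚ · t) (yᴴ j) (x≗e j)) (y≗e j) ⟩
        - e j - 2ℚ · e j - e j       ≡⟨ rearrange (e j) ⟩
        - 4ℚ · e j                   ∎
        where
        rearrange : ∀ p → - p - 2ℚ · p - p ≡ - 4ℚ · p
        rearrange = solve-∀ ℚ-ring

      b'-value : ∀ j → z b' j ≡ - 1ℚ · e j
      b'-value j = begin
        z b' j          ≡⟨ b'-sub j ⟩
        x (j ⊞ h)       ≡⟨ xᴴ j ⟩
        - e j           ≡⟨ rearrange (e j) ⟩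
        - 1ℚ · e j      ∎
        where
        rearrange : ∀ p → - p ≡ - 1ℚ · p
        rearrange = solve-∀ ℚ-ring

      a''-value : ∀ j → z a'' j ≡ 2ℚ · e j
      a''-value j = begin
        z a'' j                          ≡⟨ a''-sub j ⟩
        - (x (j ⊞ h) + x (j ⊞ 2 ⊞ h))    ≡⟨ cong₂ (λ s t → - (s + t)) (xᴴ j) (trans (xᴴ (j ⊞ 2)) (cong -_ (e-⊞2 j))) ⟩
        - (- e j + - e j)                ≡⟨ rearrange (e j) ⟩
        2ℚ · e j                         ∎
        where
        rearrange : ∀ p → - (- p + - p) ≡ 2ℚ · p
        rearrange = solve-∀ ℚ-ring

  module Elimination (z : Cls → Fin n → ℚ) (kernel : ∀ X j → adjacency z X j ≡ 0ℚ) where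

    open Substitution z kernel public
    private module Swapped = Substitution (z ∘ swap) (swap-kernel z kernel)

    reduced : ∀ j → x (j ⊟ 2 ⊞ h) + x (j ⊞ h) + x (j ⊞ 2 ⊞ h) + (2ℚ · y j + x j) ≡ 0ℚ
    reduced j = begin
      P + Q + R + (2ℚ · y j + x j)                      ≡⟨ rearrange P Q R (x j) (y j) ⟩
      - (- (Q + R) + - (P + Q) + (Q - 2ℚ · y j - x j))  ≡⟨ cong -_ row ⟨
      - (z a'' j + z a'' (j ⊟ 2) + z c'' j)             ≡⟨ cong -_ (kernel b'' j) ⟩
      0ℚ                                                ∎
      where
      P = x (j ⊟ 2 ⊞ h)
      Q = x (j ⊞ h)
      R = x (j ⊞ 2 ⊞ h)
      rearrange : ∀ p q r s t → p + q + r + (2ℚ · t + s) ≡ - (- (q + r) + - (p + q) + (q - 2ℚ · t - s))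
      rearrange = solve-∀ ℚ-ring
      a''-previous : z a'' (j ⊟ 2) ≡ - (P + Q)
      a''-previous = trans (a''-sub (j ⊟ 2)) (cong (λ i → - (P + x (i ⊞ h))) (⊟-⊞ 2≤n j))
      row : z a'' j + z a'' (j ⊟ 2) + z c'' j ≡ - (Q + R) + - (P + Q) + (Q - 2ℚ · y j - x j)
      row = cong₂ _+_ (cong₂ _+_ (a''-sub j) a''-previous) (Swapped.c'-sub j)

  module Kernel (z : Cls → Fin n → ℚ) (kernel : ∀ X j → adjacency z X j ≡ 0ℚ) where

    open Elimination z kernel public
    private module Swapped = Elimination (z ∘ swap) (swap-kernel z kernel)

    w : Fin n → ℚ
    w j = x j - y j

    w-twisted : ∀ j → w (j ⊟ 2 ⊞ h) + w (j ⊞ h) + w (j ⊞ 2 ⊞ h) + - 1ℚ · w j ≡ 0ℚ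
    w-twisted j =
      by-vanishing (difference (x (j ⊟ 2 ⊞ h)) (x (j ⊞ h)) (x (j ⊞ 2 ⊞ h)) (x j)
                               (y (j ⊟ 2 ⊞ h)) (y (j ⊞ h)) (y (j ⊞ 2 ⊞ h)) (y j))
                   (cong₂ _-_ (reduced j) (Swapped.reduced j))
      where
      difference : ∀ p q r s p′ q′ r′ s′ →
        (p - p′) + (q - q′) + (r - r′) + - 1ℚ · (s - s′)
          ≡ 0ℚ + ((p + q + r + (2ℚ · s′ + s)) - (p′ + q′ + r′ + (2ℚ · s + s′)))
      difference = solve-∀ ℚ-ring

    module W = Twisted n∣h+h {2} w (- 1ℚ) w-twisted

    w-zero : ∀ j → w j ≡ 0ℚ
    w-zero j = by-vanishing (halves (w j) (w (j ⊞ h))) (cong₂ (λ s t → ½ · s + ½ · t) (even-zero j) (odd-zero j))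
      where
      even-zero : ∀ j → W.even-part j ≡ 0ℚ
      even-zero = recurrence-0⇒zero W.even-part k 2≤n n∣h*2 W.even-part-recurrence
      odd-zero : ∀ j → W.odd-part j ≡ 0ℚ
      odd-zero = recurrence-2⇒zero W.odd-part k 2≤n n∣h*2 W.odd-part-recurrence
      halves : ∀ p q → p ≡ 0ℚ + (½ · (p + q) + ½ · (p - q))
      halves = solve-∀ ℚ-ring

    y≗x : ∀ j → y j ≡ x j
    y≗x j = by-vanishing (rearrange (x j) (y j)) (cong -_ (w-zero j))
      where
      rearrange : ∀ p q → q ≡ p + - (p - q)
      rearrange = solve-∀ ℚ-ring

    x-twisted : ∀ j → x (j ⊟ 2 ⊞ h) + x (j ⊞ h) + x (j ⊞ 2 ⊞ h) + 3ℚ · x j ≡ 0ℚ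
    x-twisted j = trans (cong (_+_ (x (j ⊟ 2 ⊞ h) + x (j ⊞ h) + x (j ⊞ 2 ⊞ h))) (sym three-x)) (reduced j)
      where
      rearrange : ∀ p → 2ℚ · p + p ≡ 3ℚ · p
      rearrange = solve-∀ ℚ-ring
      three-x : 2ℚ · y j + x j ≡ 3ℚ · x j
      three-x = trans (cong (λ t → 2ℚ · t + x j) (y≗x j)) (rearrange (x j))

    module X = Twisted n∣h+h {2} x 3ℚ x-twisted

    x-⊞h : ∀ j → x (j ⊞ h) ≡ - x j
    x-⊞h j = by-vanishing (rearrange (x j) (x (j ⊞ h))) (dominant⇒zero 2 X.even-part 2<4 X.even-part-recurrence j)
      where
      2<4 : 2ℚ ℚ.< 1ℚ + 3ℚ
      2<4 = toWitness {a? = 2ℚ ℚₚ.<? (1ℚ + 3ℚ)} tt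
      rearrange : ∀ p q → q ≡ - p + (p + q)
      rearrange = solve-∀ ℚ-ring

    x-⊞2 : ∀ j → x (j ⊞ 2) ≡ x j
    x-⊞2 j = begin
      x (j ⊞ 2)                ≡⟨ half-odd-part (j ⊞ 2) ⟩
      ½ · X.odd-part (j ⊞ 2)   ≡⟨ cong (½ ·_) (harmonic⇒invariant X.odd-part 2≤n X.odd-part-recurrence j) ⟩
      ½ · X.odd-part j         ≡⟨ half-odd-part j ⟨
      x j                      ∎
      where
      rearrange : ∀ p → p ≡ ½ · (p - - p)
      rearrange = solve-∀ ℚ-ring
      half-odd-part : ∀ i → x i ≡ ½ · X.odd-part i
      half-odd-part i = trans (rearrange (x i)) (cong (λ t → ½ · (x i - t)) (sym (x-⊞h i)))

    x-⊞1 : ∀ j → x (j ⊞ 1) ≡ - x j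
    x-⊞1 j = begin
      x (j ⊞ 1)                ≡⟨ iterate-invariant x x-⊞2 k (j ⊞ 1) ⟨
      x (j ⊞ 1 ⊞ (k * 2))      ≡⟨ cong x (⊞-assoc j 1 (k * 2)) ⟩
      x (j ⊞ h)                ≡⟨ x-⊞h j ⟩
      - x j                    ∎

    x-alternating : ∀ j → x j ≡ x origin · alternating j
    x-alternating j = begin
      x j                          ≡⟨ cong x (origin-⊞ j) ⟨
      x (origin ⊞ toℕ j)           ≡⟨ cong (λ t → x (origin ⊞ t)) (ℕₚ.*-identityʳ (toℕ j)) ⟨
      x (origin ⊞ (toℕ j * 1))     ≡⟨ iterate-anti-invariant x x-⊞1 (toℕ j) origin ⟩
      alternating j · x origin     ≡⟨ ℚₚ.*-comm (alternating j) (x origin) ⟩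
      x origin · alternating j     ∎

    open Values x (λ _ → refl) y≗x x-⊞2 x-⊞h
    private module Swapped-values = Swapped.Values x y≗x (λ _ → refl) x-⊞2 x-⊞h

    kernel-values : ∀ X j → z X j ≡ coefficient X · x j
    kernel-values a'    = Swapped-values.a''-value
    kernel-values a''   = a''-value
    kernel-values b'    = b'-value
    kernel-values b''   = Swapped-values.b'-value
    kernel-values c'    = c'-value
    kernel-values c''   = Swapped-values.c'-value
    kernel-values d'    = d'-value
    kernel-values d''   = Swapped-values.d'-value
    kernel-values e'  j = sym (ℚₚ.*-identityˡ (x j))
    kernel-values e'' j = trans (y≗x j) (sym (ℚₚ.*-identityˡ (x j)))
    kernel-values f     = f-value

    kernel-multiple : ∀ X j → z X j ≡ x origin · nut-vector X j
    kernel-multiple X j = begin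
      z X j                                       ≡⟨ kernel-values X j ⟩
      coefficient X · x j                         ≡⟨ cong (coefficient X ·_) (x-alternating j) ⟩
      coefficient X · (x origin · alternating j)  ≡⟨ exchange (coefficient X) (x origin) (alternating j) ⟩
      x origin · nut-vector X j                   ∎
      where
      exchange : ∀ p q r → p · (q · r) ≡ q · (p · r)
      exchange = solve-∀ ℚ-ring

  index : Cls → Fin 11
  index a'  = # 0
  index a'' = # 1
  index b'  = # 2
  index b'' = # 3
  index c'  = # 4
  index c'' = # 5
  index d'  = # 6
  index d'' = # 7
  index e'  = # 8
  index e'' = # 9
  index f   = # 10

  cls-index : ∀ X → cls (index X) ≡ X
  cls-index a'  = refl
  cls-index a'' = refl
  cls-index b'  = refl
  cls-index b'' = refl
  cls-index c'  = refl
  cls-index c'' = refl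
  cls-index d'  = refl
  cls-index d'' = refl
  cls-index e'  = refl
  cls-index e'' = refl
  cls-index f   = refl

  index-cls : ∀ c → index (cls c) ≡ c
  index-cls = toWitness {a? = Finₚ.all? (λ c → index (cls c) Finₚ.≟ c)} tt

  unlift : (Fin (11 * n) → ℚ) → Cls → Fin n → ℚ
  unlift u X j = u (combine (index X) j)

  lift-unlift : ∀ u v → lift (unlift u) v ≡ u v
  lift-unlift u v = trans (cong (λ c → u (combine c j)) (index-cls c)) (cong u (Finₚ.combine-remQuot {11} n v))
    where
    c = proj₁ (remQuot {11} n v)
    j = proj₂ (remQuot {11} n v)

  unlift-kernel : ∀ u → InNullSpace (11 * n) G u → ∀ X j → adjacency (unlift u) X j ≡ 0ℚ
  unlift-kernel u null X j = begin
    adjacency (unlift u) X j                                     ≡⟨ cong (uncurry (adjacency (unlift u))) vtx-i ⟨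
    uncurry (adjacency (unlift u)) (vtx n i)                     ≡⟨ adjMatrix-lift (unlift u) i ⟨
    sumFin (11 * n) (λ v → adjMatrix G i v · lift (unlift u) v)  ≡⟨ sumFin-cong (11 * n) lift-unlift-summand ⟩
    sumFin (11 * n) (λ v → adjMatrix G i v · u v)                ≡⟨ null i ⟩
    0ℚ                                                           ∎
    where
    i = combine (index X) j
    vtx-i : vtx n i ≡ (X , j)
    vtx-i = trans (vtx-combine (index X) j) (cong (_, j) (cls-index X))
    lift-unlift-summand : ∀ v → adjMatrix G i v · lift (unlift u) v ≡ adjMatrix G i v · u v
    lift-unlift-summand v = cong (_·_ (adjMatrix G i v)) (lift-unlift u v)

  gen-irreflexive : ∀ p → gen n (+ 2) (+ 2) p p ≡ false
  gen-irreflexive (a'  , j) = refl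
  gen-irreflexive (a'' , j) = refl
  gen-irreflexive (b'  , j) = refl
  gen-irreflexive (b'' , j) = refl
  gen-irreflexive (c'  , j) = eqB-false (not-antipodal j)
  gen-irreflexive (c'' , j) = eqB-false (not-antipodal j)
  gen-irreflexive (d'  , j) = eqB-false (not-antipodal j)
  gen-irreflexive (d'' , j) = eqB-false (not-antipodal j)
  gen-irreflexive (e'  , j) = refl
  gen-irreflexive (e'' , j) = refl
  gen-irreflexive (f   , j) = eqB-false (not-antipodal j)

  simple : IsSimple (11 * n) G
  simple = (λ u v → ∨-comm (gen n (+ 2) (+ 2) (vtx n u) (vtx n v)) (gen n (+ 2) (+ 2) (vtx n v) (vtx n u)))
         , (λ u → cong (λ b → b ∨ b) (gen-irreflexive (vtx n u)))

  nut : IsNutGraph (11 * n) G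
  nut = 2≤11n , simple , lift nut-vector , nonzero , in-kernel , unique
    where
    2≤11n : 2 ≤ 11 * n
    2≤11n = ℕₚ.≤-trans 2≤n (ℕₚ.m≤m+n n (10 * n))
    nonzero : ∀ v → lift nut-vector v ≢ 0ℚ
    nonzero v = nut-vector-nonzero (proj₁ (vtx n v)) (proj₂ (vtx n v))
    in-kernel : InNullSpace (11 * n) G (lift nut-vector)
    in-kernel i = trans (adjMatrix-lift nut-vector i) (nut-vector-kernel (proj₁ (vtx n i)) (proj₂ (vtx n i)))
    unique : ∀ u → InNullSpace (11 * n) G u → ∃ λ κ → ∀ v → u v ≡ κ · lift nut-vector v
    unique u null = x origin , multiple
      where
      open Kernel (unlift u) (unlift-kernel u null) using (x; kernel-multiple)
      multiple : ∀ v → u v ≡ x origin · lift nut-vector v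
      multiple v = trans (sym (lift-unlift u v)) (kernel-multiple (proj₁ (vtx n v)) (proj₂ (vtx n v)))

proposition13 : (n : ℕ) .{{_ : NonZero n}} → 6 ≤ n → n % 4 ≡ 2
    → IsNutGraph (11 * n) (G11 n (+ 2) (+ 2))
proposition13 n 6≤n n%4≡2 = Graph.nut n (n / 4) n≡h*2 (ℕₚ.≤-trans (s≤s (s≤s (s≤s z≤n))) 6≤n)
  where
  open ≡-Reasoning
  n≡h*2 : n ≡ suc (n / 4 * 2) * 2
  n≡h*2 = begin
    n                      ≡⟨ m≡m%n+[m/n]*n n 4 ⟩
    n % 4 ℕ.+ n / 4 * 4    ≡⟨ cong (ℕ._+ n / 4 * 4) n%4≡2 ⟩
    2 ℕ.+ n / 4 * 4        ≡⟨ cong (2 ℕ.+_) (ℕₚ.*-assoc (n / 4) 2 2) ⟨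
    suc (n / 4 * 2) * 2    ∎
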